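{- Let $m$ be real and let $\alpha_0,\alpha_1,\ldots$ be real numbers. Let $\mathbf{L}$ be the infinite lower triangular matrix $(L_{m,\bar{\alpha}}(n,k))_{n,k\ge0}$ and let $\mathbf{D}$ be the infinite diagonal matrix with entries $D(n,k)=(-1)^n\delta_{nk}$. Then $\mathbf{L}$ is invertible (as an infinite lower triangular matrix) and $\mathbf{L}^{ -1}=\mathbf{D}\mathbf{L}\mathbf{D}$.
   Context: For real $m$ and reals $\bar{\alpha}=(\alpha_0,\alpha_1,\ldots)$ let $(x;\bar{\alpha}|m)_n=\prod_{j=0}^{n-1}(x-\alpha_j-jm)$ with $(x;\bar{\alpha}|m)_0=1$. The $\bar{\alpha}$-Whitney numbers of the first kind $w_{m,\bar{\alpha}}(n,k)$ and second kind $W_{m,\bar{\alpha}}(n,k)$ are defined by $(x;\bar{\alpha}|m)_n=\sum_{k=0}^n w_{m,\bar{\alpha}}(n,k)x^k$ and $x^n=\sum_{k=0}^n W_{m,\bar{\alpha}}(n,k)(x;\bar{\alpha}|m)_k$ (both zero for $k>n$ or $k<0$). The $\bar{\alpha}$-Whitney-Lah numbers are $L_{m,\bar{\alpha}}(n,k)=\sum_{j=k}^n(-1)^{n-j}w_{m,\bar{\alpha}}(n,j)W_{m,\bar{\alpha}}(j,k)$, with $L_{m,\bar{\alpha}}(n,k)=0$ for $n<k$. Products of infinite lower triangular matrices are well defined since each entry is a finite sum. -}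

module Defs where

open import Level using (Level)
open import Algebra.Bundles using (CommutativeRing)
open import Data.Nat using (ℕ; zero; suc; _∸_; _<_; _≡ᵇ_)
open import Data.Nat using () renaming (_+_ to _+ℕ_)
open import Data.List using (List; []; _∷_; map; replicate; _++_)
open import Data.Bool using (if_then_else_)

-- All notions are developed over an arbitrary commutative ring R
-- (the paper works over the reals).
module _ {c ℓ : Level} (R : CommutativeRing c ℓ) where
  open CommutativeRing R

  -- Polynomials in x as coefficient lists, lowest degree first.
  Poly : Set c
  Poly = List Carrier

  coeff : Poly → ℕ → Carrier
  coeff [] _ = 0#
  coeff (a ∷ p) zero = a
  coeff (a ∷ p) (suc i) = coeff p i

  addP : Poly → Poly → Poly
  addP [] q = q
  addP p [] = p
  addP (a ∷ p) (b ∷ q) = (a + b) ∷ addP p q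

  mulLin : Carrier → Poly → Poly
  mulLin a p = addP (0# ∷ p) (map (λ b → - (a * b)) p)

  natMul : ℕ → Carrier → Carrier
  natMul zero r = 0#
  natMul (suc n) r = natMul n r + r

  -- (x; ᾱ | m)_n = ∏_{j=0}^{n-1} (x - α_j - j m)
  genFall : (ℕ → Carrier) → Carrier → ℕ → Poly
  genFall α m zero = 1# ∷ []
  genFall α m (suc n) = mulLin (α n + natMul n m) (genFall α m n)

  xPow : ℕ → Poly
  xPow n = replicate n 0# ++ (1# ∷ [])

  sumN : ℕ → (ℕ → Carrier) → Carrier
  sumN zero f = 0#
  sumN (suc n) f = sumN n f + f n

  sign : ℕ → Carrier
  sign zero = 1#
  sign (suc n) = - sign n

  -- ᾱ-Whitney numbers of the first kind: coefficient of x^k in (x;ᾱ|m)_n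
  -- (automatically 0 for k > n)
  whitney1 : (ℕ → Carrier) → Carrier → ℕ → ℕ → Carrier
  whitney1 α m n k = coeff (genFall α m n) k

  -- W is the array of ᾱ-Whitney numbers of the second kind:
  -- x^n = Σ_{k=0}^n W(n,k) (x;ᾱ|m)_k as polynomials, and W(n,k) = 0 for k > n.
  IsWhitney2 : (ℕ → Carrier) → Carrier → (ℕ → ℕ → Carrier) → Set ℓ
  IsWhitney2 α m W =
    (∀ n i → coeff (xPow n) i ≈ sumN (suc n) (λ k → W n k * coeff (genFall α m k) i))
    × (∀ n k → n < k → W n k ≈ 0#)
    where open import Data.Product using (_×_)

  -- L(n,k) = Σ_{j=k}^n (-1)^{n-j} w(n,j) W(j,k)   (empty sum, i.e. 0, when n < k)
  whitneyLah : (ℕ → Carrier) → Carrier → (ℕ → ℕ → Carrier) → ℕ → ℕ → Carrier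
  whitneyLah α m W n k =
    sumN (suc n ∸ k) (λ i → sign (n ∸ (k +ℕ i)) * whitney1 α m n (k +ℕ i) * W (k +ℕ i) k)

  Matrix : Set c
  Matrix = ℕ → ℕ → Carrier

  -- product of infinite lower triangular matrices:
  -- (AB)(n,k) = Σ_{j=0}^{n} A(n,j) B(j,k)  (terms j > n vanish since A is lower triangular)
  lowerMul : Matrix → Matrix → Matrix
  lowerMul A B n k = sumN (suc n) (λ j → A n j * B j k)

  identityM : Matrix
  identityM n k = if n ≡ᵇ k then 1# else 0#

  signDiag : Matrix
  signDiag n k = if n ≡ᵇ k then sign n else 0#

-- Write w for the Whitney numbers of the first kind, W for those of the
-- second kind and D for the sign matrix. The defining expansions say
-- W·w = I; since w is lower unitriangular it cancels on the right, so also
-- w·W = I. As (-1)^(n-j) = (-1)^n (-1)^j, the Whitney-Lah matrix is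
-- L = D·w·D·W = D·K with K = w·D·W, and K is an involution:
-- K·K = w·D·(W·w)·D·W = w·W = I. Hence D·L·D = K·D, whose products with
-- L = D·K in either order collapse to I.
module Submission where

open import Defs
open import Level using (Level)
open import Algebra.Bundles using (CommutativeRing)
open import Data.Nat using (ℕ)
open import Data.Product using (_×_)
open import Data.Nat
  using (zero; suc; _<_; _≤_; _∸_; s≤s; _≡ᵇ_; _≟_; _<?_; _≤?_)
  renaming (_+_ to _+ℕ_)
open import Data.Nat.Properties
  using ( ≤-refl; ≤-trans; ≤-pred; ≤-<-trans; <-trans; <-irrefl; <-cmp; <⇒≤; ≰⇒>; ≮⇒≥
        ; n<1+n; m<n⇒m<1+n; ≤∧≢⇒<; m≤m+n; m≤n+m; +-monoʳ-<; +-suc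
        ; m+[n∸m]≡n; m∸n+n≡m; m≤n⇒m∸n≡0; ≡ᵇ⇒≡; ≡⇒≡ᵇ)
  renaming (+-identityʳ to ℕ-+-identityʳ)
open import Data.Product using (_,_; proj₁; proj₂)
open import Data.List using ([]; _∷_; map)
open import Data.Bool using (true; false; if_then_else_; T)
open import Data.Empty using (⊥-elim)
open import Data.Unit using (tt)
open import Relation.Binary.Bundles using (Setoid)
open import Relation.Binary.Definitions using (tri<; tri≈; tri>)
open import Relation.Binary.PropositionalEquality as ≡ using (_≡_; _≢_)
open import Relation.Nullary using (yes; no)
import Relation.Binary.Reasoning.Setoid as SetoidReasoning

module WhitneyMatrices {c ℓ : Level} (R : CommutativeRing c ℓ) where
  open CommutativeRing R
  open import Algebra.Properties.Ring ring
    using (-0#≈0#; +-cancelˡ; +-cancelʳ; -‿distribʳ-*; -‿distribˡ-*; -‿involutive)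
  open import Algebra.Properties.CommutativeSemigroup +-commutativeSemigroup
    using (interchange)
  module ≈-Reasoning = SetoidReasoning setoid

  *-vanishesʳ : ∀ {x y} → y ≈ 0# → x * y ≈ 0#
  *-vanishesʳ y≈0 = trans (*-congˡ y≈0) (zeroʳ _)

  *-vanishesˡ : ∀ {x y} → x ≈ 0# → x * y ≈ 0#
  *-vanishesˡ x≈0 = trans (*-congʳ x≈0) (zeroˡ _)

  -- Finite sums

  sumN-cong : ∀ N {f g} → (∀ i → i < N → f i ≈ g i) → sumN R N f ≈ sumN R N g
  sumN-cong zero    f≈g = refl
  sumN-cong (suc N) f≈g =
    +-cong (sumN-cong N (λ i i<N → f≈g i (m<n⇒m<1+n i<N))) (f≈g N ≤-refl)

  sumN-zero : ∀ N {f} → (∀ i → i < N → f i ≈ 0#) → sumN R N f ≈ 0#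
  sumN-zero zero    f≈0 = refl
  sumN-zero (suc N) f≈0 =
    trans (+-cong (sumN-zero N (λ i i<N → f≈0 i (m<n⇒m<1+n i<N))) (f≈0 N ≤-refl))
          (+-identityʳ 0#)

  sumN-+ : ∀ N f g → sumN R N (λ i → f i + g i) ≈ sumN R N f + sumN R N g
  sumN-+ zero    f g = sym (+-identityʳ 0#)
  sumN-+ (suc N) f g = trans (+-congʳ (sumN-+ N f g)) (interchange _ _ _ _)

  *-distribˡ-sumN : ∀ N x f → x * sumN R N f ≈ sumN R N (λ i → x * f i)
  *-distribˡ-sumN zero    x f = zeroʳ x
  *-distribˡ-sumN (suc N) x f =
    trans (distribˡ x _ (f N)) (+-congʳ (*-distribˡ-sumN N x f))

  *-distribʳ-sumN : ∀ N x f → sumN R N f * x ≈ sumN R N (λ i → f i * x)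
  *-distribʳ-sumN zero    x f = zeroˡ x
  *-distribʳ-sumN (suc N) x f =
    trans (distribʳ x _ (f N)) (+-congʳ (*-distribʳ-sumN N x f))

  sumN-comm : ∀ a b (f : ℕ → ℕ → Carrier) →
    sumN R a (λ i → sumN R b (f i)) ≈ sumN R b (λ j → sumN R a (λ i → f i j))
  sumN-comm zero    b f = sym (sumN-zero b (λ _ _ → refl))
  sumN-comm (suc a) b f =
    trans (+-congʳ (sumN-comm a b f)) (sym (sumN-+ b (λ j → sumN R a (λ i → f i j)) (f a)))

  sumN-+ℕ : ∀ a b f → sumN R (a +ℕ b) f ≈ sumN R a f + sumN R b (λ i → f (a +ℕ i))
  sumN-+ℕ a zero f rewrite ℕ-+-identityʳ a = sym (+-identityʳ _)
  sumN-+ℕ a (suc b) f rewrite +-suc a b =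
    trans (+-congʳ (sumN-+ℕ a b f)) (+-assoc _ _ _)

  sumN-split : ∀ {a b} f → a ≤ b →
    sumN R b f ≈ sumN R a f + sumN R (b ∸ a) (λ i → f (a +ℕ i))
  sumN-split {a} {b} f a≤b = begin
    sumN R b f                ≡⟨ ≡.cong (λ N → sumN R N f) (m+[n∸m]≡n a≤b) ⟨
    sumN R (a +ℕ (b ∸ a)) f   ≈⟨ sumN-+ℕ a (b ∸ a) f ⟩
    sumN R a f + sumN R (b ∸ a) (λ i → f (a +ℕ i)) ∎
    where open ≈-Reasoning

  sumN-truncate : ∀ {a b} f → a ≤ b → (∀ t → f (a +ℕ t) ≈ 0#) → sumN R b f ≈ sumN R a f
  sumN-truncate {a} {b} f a≤b tail≈0 =
    trans (sumN-split f a≤b)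
          (trans (+-congˡ (sumN-zero (b ∸ a) (λ t _ → tail≈0 t))) (+-identityʳ _))

  sumN-dropˡ : ∀ N k f → (∀ j → j < k → f j ≈ 0#) →
    sumN R N f ≈ sumN R (N ∸ k) (λ i → f (k +ℕ i))
  sumN-dropˡ N k f head≈0 with k ≤? N
  ... | yes k≤N =
    trans (sumN-split f k≤N) (trans (+-congʳ (sumN-zero k head≈0)) (+-identityˡ _))
  ... | no k≰N rewrite m≤n⇒m∸n≡0 (<⇒≤ (≰⇒> k≰N)) =
    sumN-zero N (λ j j<N → head≈0 j (<-trans j<N (≰⇒> k≰N)))

  sumN-single : ∀ N j {f} → j < N → (∀ i → i < N → i ≢ j → f i ≈ 0#) → sumN R N f ≈ f j
  sumN-single (suc N) j j<1+N others≈0 with j ≟ N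
  ... | yes ≡.refl =
    trans (+-congʳ (sumN-zero N (λ i i<N → others≈0 i (m<n⇒m<1+n i<N) (λ { ≡.refl → <-irrefl ≡.refl i<N }))))
          (+-identityˡ _)
  ... | no j≢N =
    trans (+-cong (sumN-single N j (≤∧≢⇒< (≤-pred j<1+N) j≢N)
                                   (λ i i<N → others≈0 i (m<n⇒m<1+n i<N)))
                  (others≈0 N ≤-refl (λ N≡j → j≢N (≡.sym N≡j))))
          (+-identityʳ _)

  sumN-cancel : ∀ N j {f g} → j < N → (∀ i → i < N → i ≢ j → f i ≈ g i) →
    sumN R N f ≈ sumN R N g → f j ≈ g j
  sumN-cancel (suc N) j {f} {g} j<1+N others sums≈ with j ≟ N
  ... | yes ≡.refl =
    +-cancelˡ (sumN R N f) (f N) (g N)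
      (trans sums≈ (+-congʳ (sym (sumN-cong N (λ i i<N →
        others i (m<n⇒m<1+n i<N) (λ { ≡.refl → <-irrefl ≡.refl i<N }))))))
  ... | no j≢N =
    sumN-cancel N j (≤∧≢⇒< (≤-pred j<1+N) j≢N) (λ i i<N → others i (m<n⇒m<1+n i<N))
      (+-cancelʳ (f N) (sumN R N f) (sumN R N g)
        (trans sums≈ (+-congˡ (sym (others N ≤-refl (λ N≡j → j≢N (≡.sym N≡j)))))))

  -- Matrices

  infixl 7 _·_
  _·_ : Matrix R → Matrix R → Matrix R
  _·_ = lowerMul R

  infix 4 _≐_
  _≐_ : Matrix R → Matrix R → Set ℓ
  A ≐ B = ∀ n k → A n k ≈ B n k

  ≐-setoid : Setoid c ℓ
  ≐-setoid = record
    { Carrier       = Matrix R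
    ; _≈_           = _≐_
    ; isEquivalence = record
      { refl  = λ n k → refl
      ; sym   = λ A≐B n k → sym (A≐B n k)
      ; trans = λ A≐B B≐C n k → trans (A≐B n k) (B≐C n k)
      }
    }

  module ≐-Reasoning = SetoidReasoning ≐-setoid

  LowerTriangular : Matrix R → Set ℓ
  LowerTriangular A = ∀ {n k} → n < k → A n k ≈ 0#

  Diagonal : Matrix R → Set ℓ
  Diagonal G = ∀ {n k} → n ≢ k → G n k ≈ 0#

  diagonal⇒lowerTriangular : ∀ {G} → Diagonal G → LowerTriangular G
  diagonal⇒lowerTriangular dG n<k = dG (λ { ≡.refl → <-irrefl ≡.refl n<k })

  -- Both the identity and the sign matrix are of this shape, definitionally.
  diag : (ℕ → Carrier) → Matrix R
  diag d n k = if n ≡ᵇ k then d n else 0#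

  diag-on : ∀ d n → diag d n n ≈ d n
  diag-on d n with n ≡ᵇ n in eq
  ... | true  = refl
  ... | false = ⊥-elim (≡.subst T eq (≡⇒≡ᵇ n n ≡.refl))

  diag-off : ∀ d → Diagonal (diag d)
  diag-off d {n} {k} n≢k with n ≡ᵇ k in eq
  ... | true  = ⊥-elim (n≢k (≡ᵇ⇒≡ n k (≡.subst T (≡.sym eq) tt)))
  ... | false = refl

  I D : Matrix R
  I = identityM R
  D = signDiag R

  I-diagonal : Diagonal I
  I-diagonal = diag-off (λ _ → 1#)

  D-diagonal : Diagonal D
  D-diagonal = diag-off (sign R)

  D-lowerTriangular : LowerTriangular D
  D-lowerTriangular = diagonal⇒lowerTriangular D-diagonal

  ·-cong : ∀ {A A′ B B′} → A ≐ A′ → B ≐ B′ → A · B ≐ A′ · B′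
  ·-cong A≐A′ B≐B′ n k = sumN-cong (suc n) (λ j _ → *-cong (A≐A′ n j) (B≐B′ j k))

  ·-congˡ : ∀ A {B B′} → B ≐ B′ → A · B ≐ A · B′
  ·-congˡ A = ·-cong {A} (λ n k → refl)

  ·-congʳ : ∀ {A A′} B → A ≐ A′ → A · B ≐ A′ · B
  ·-congʳ B A≐A′ = ·-cong A≐A′ (λ n k → refl {B n k})

  ·-lowerTriangular : ∀ A {B} → LowerTriangular B → LowerTriangular (A · B)
  ·-lowerTriangular A lB n<k =
    sumN-zero _ (λ j j<1+n → *-vanishesʳ (lB (≤-<-trans (≤-pred j<1+n) n<k)))

  ·-assoc : ∀ A {B} C → LowerTriangular B → (A · B) · C ≐ A · (B · C)
  ·-assoc A {B} C lB n k = begin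
    sumN R N (λ j → sumN R N (λ i → A n i * B i j) * C j k)
      ≈⟨ sumN-cong N (λ j _ → *-distribʳ-sumN N (C j k) _) ⟩
    sumN R N (λ j → sumN R N (λ i → A n i * B i j * C j k))
      ≈⟨ sumN-comm N N (λ j i → A n i * B i j * C j k) ⟩
    sumN R N (λ i → sumN R N (λ j → A n i * B i j * C j k))
      ≈⟨ sumN-cong N (λ i _ → sumN-cong N (λ j _ → *-assoc _ _ _)) ⟩
    sumN R N (λ i → sumN R N (λ j → A n i * (B i j * C j k)))
      ≈⟨ sumN-cong N (λ i _ → *-distribˡ-sumN N (A n i) _) ⟨
    sumN R N (λ i → A n i * sumN R N (λ j → B i j * C j k))
      ≈⟨ sumN-cong N (λ i i<N → *-congˡ (sumN-truncate _ i<N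
           (λ t → *-vanishesˡ (lB (s≤s (m≤m+n i t)))))) ⟩
    sumN R N (λ i → A n i * sumN R (suc i) (λ j → B i j * C j k)) ∎
    where
    N = suc n
    open ≈-Reasoning

  diagonal-· : ∀ {G} A → Diagonal G → ∀ n k → (G · A) n k ≈ G n n * A n k
  diagonal-· A dG n k =
    sumN-single (suc n) n ≤-refl (λ i _ i≢n → *-vanishesˡ (dG (λ n≡i → i≢n (≡.sym n≡i))))

  ·-diagonal : ∀ {A G} → LowerTriangular A → Diagonal G → ∀ n k → (A · G) n k ≈ A n k * G k k
  ·-diagonal lA dG n k with k ≤? n
  ... | yes k≤n = sumN-single (suc n) k (s≤s k≤n) (λ i _ i≢k → *-vanishesʳ (dG i≢k))
  ... | no k≰n =
    trans (sumN-zero (suc n) (λ i i<1+n →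
             *-vanishesʳ (diagonal⇒lowerTriangular dG (≤-<-trans (≤-pred i<1+n) (≰⇒> k≰n)))))
          (sym (*-vanishesˡ (lA (≰⇒> k≰n))))

  ·-identityˡ : ∀ A → I · A ≐ A
  ·-identityˡ A n k =
    trans (diagonal-· A I-diagonal n k)
          (trans (*-congʳ (diag-on (λ _ → 1#) n)) (*-identityˡ _))

  ·-identityʳ : ∀ {A} → LowerTriangular A → A · I ≐ A
  ·-identityʳ lA n k =
    trans (·-diagonal lA I-diagonal n k)
          (trans (*-congˡ (diag-on (λ _ → 1#) k)) (*-identityʳ _))

  -- Signs

  sign-+ : ∀ a b → sign R (a +ℕ b) ≈ sign R a * sign R b
  sign-+ zero    b = sym (*-identityˡ _)
  sign-+ (suc a) b = trans (-‿cong (sign-+ a b)) (-‿distribˡ-* _ _)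

  sign-square : ∀ n → sign R n * sign R n ≈ 1#
  sign-square zero    = *-identityˡ 1#
  sign-square (suc n) = begin
    - sign R n * - sign R n     ≈⟨ -‿distribˡ-* _ _ ⟨
    - (sign R n * - sign R n)   ≈⟨ -‿cong (-‿distribʳ-* _ _) ⟨
    - - (sign R n * sign R n)   ≈⟨ -‿involutive _ ⟩
    sign R n * sign R n         ≈⟨ sign-square n ⟩
    1#                          ∎
    where open ≈-Reasoning

  sign-∸ : ∀ {n j} → j ≤ n → sign R (n ∸ j) ≈ sign R n * sign R j
  sign-∸ {n} {j} j≤n = begin
    sign R (n ∸ j)                          ≈⟨ *-identityʳ _ ⟨
    sign R (n ∸ j) * 1#                     ≈⟨ *-congˡ (sign-square j) ⟨
    sign R (n ∸ j) * (sign R j * sign R j)  ≈⟨ *-assoc _ _ _ ⟨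
    sign R (n ∸ j) * sign R j * sign R j    ≈⟨ *-congʳ (sign-+ (n ∸ j) j) ⟨
    sign R (n ∸ j +ℕ j) * sign R j          ≡⟨ ≡.cong (λ i → sign R i * sign R j) (m∸n+n≡m j≤n) ⟩
    sign R n * sign R j                     ∎
    where open ≈-Reasoning

  D·D≐I : D · D ≐ I
  D·D≐I n k with n ≟ k
  ... | yes ≡.refl =
    trans (diagonal-· D D-diagonal n n)
      (trans (*-cong (diag-on (sign R) n) (diag-on (sign R) n))
        (trans (sign-square n) (sym (diag-on (λ _ → 1#) n))))
  ... | no n≢k =
    trans (diagonal-· D D-diagonal n k)
      (trans (*-vanishesʳ (D-diagonal n≢k)) (sym (I-diagonal n≢k)))

  D·D·A≐A : ∀ A → D · (D · A) ≐ A
  D·D·A≐A A = begin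
    D · (D · A)   ≈⟨ ·-assoc D A D-lowerTriangular ⟨
    D · D · A     ≈⟨ ·-congʳ A D·D≐I ⟩
    I · A         ≈⟨ ·-identityˡ A ⟩
    A             ∎
    where open ≐-Reasoning

  alternating : Matrix R → Matrix R
  alternating A n j = sign R (n ∸ j) * A n j

  alternating≐D·A·D : ∀ {A} → LowerTriangular A → alternating A ≐ D · A · D
  alternating≐D·A·D {A} lA n j with j ≤? n
  ... | yes j≤n = sym (begin
    (D · A · D) n j                       ≈⟨ ·-diagonal (·-lowerTriangular D lA) D-diagonal n j ⟩
    (D · A) n j * D j j                   ≈⟨ *-cong (diagonal-· A D-diagonal n j) (diag-on (sign R) j) ⟩
    D n n * A n j * sign R j              ≈⟨ *-congʳ (*-congʳ (diag-on (sign R) n)) ⟩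
    sign R n * A n j * sign R j           ≈⟨ *-assoc _ _ _ ⟩
    sign R n * (A n j * sign R j)         ≈⟨ *-congˡ (*-comm _ _) ⟩
    sign R n * (sign R j * A n j)         ≈⟨ *-assoc _ _ _ ⟨
    sign R n * sign R j * A n j           ≈⟨ *-congʳ (sign-∸ j≤n) ⟨
    sign R (n ∸ j) * A n j                ∎)
    where open ≈-Reasoning
  ... | no j≰n =
    trans (*-vanishesʳ (lA (≰⇒> j≰n)))
          (sym (·-lowerTriangular (D · A) D-lowerTriangular (≰⇒> j≰n)))

  -- Row n of A·U, for U lower unitriangular, determines A n j by descending induction on j.
  ·-cancelʳ-unitriangular : ∀ {A B U} → LowerTriangular A → LowerTriangular B →
    LowerTriangular U → (∀ j → U j j ≈ 1#) → A · U ≐ B · U → A ≐ B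
  ·-cancelʳ-unitriangular {A} {B} {U} lA lB lU Ujj≈1 AU≐BU n j =
    agreeFrom (suc n) j (m≤m+n (suc n) j)
    where
    column : ∀ j → j ≤ n → (∀ i → j < i → A n i ≈ B n i) → A n j ≈ B n j
    column j j≤n right = begin
      A n j          ≈⟨ *-identityʳ _ ⟨
      A n j * 1#     ≈⟨ *-congˡ (Ujj≈1 j) ⟨
      A n j * U j j  ≈⟨ sumN-cancel (suc n) j (s≤s j≤n) termsAgree (AU≐BU n j) ⟩
      B n j * U j j  ≈⟨ *-congˡ (Ujj≈1 j) ⟩
      B n j * 1#     ≈⟨ *-identityʳ _ ⟩
      B n j          ∎
      where
      open ≈-Reasoning
      termsAgree : ∀ i → i < suc n → i ≢ j → A n i * U i j ≈ B n i * U i j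
      termsAgree i _ i≢j with <-cmp i j
      ... | tri< i<j _ _ = trans (*-vanishesʳ (lU i<j)) (sym (*-vanishesʳ (lU i<j)))
      ... | tri≈ _ i≡j _ = ⊥-elim (i≢j i≡j)
      ... | tri> _ _ j<i = *-congʳ (right i j<i)

    agreeFrom : ∀ d j → n < d +ℕ j → A n j ≈ B n j
    agreeFrom zero    j n<j     = trans (lA n<j) (sym (lB n<j))
    agreeFrom (suc d) j n<1+d+j with n <? d +ℕ j
    ... | yes n<d+j = agreeFrom d j n<d+j
    ... | no n≮d+j  = column j (≤-trans (m≤n+m j d) (≮⇒≥ n≮d+j))
      (λ i j<i → agreeFrom d i (≤-<-trans (≤-pred n<1+d+j) (+-monoʳ-< d j<i)))

  -- Polynomial coefficients

  coeff-addP : ∀ p q i → coeff R (addP R p q) i ≈ coeff R p i + coeff R q i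
  coeff-addP []      q       i       = sym (+-identityˡ _)
  coeff-addP (a ∷ p) []      i       = sym (+-identityʳ _)
  coeff-addP (a ∷ p) (b ∷ q) zero    = refl
  coeff-addP (a ∷ p) (b ∷ q) (suc i) = coeff-addP p q i

  coeff-map : ∀ f → f 0# ≈ 0# → ∀ p i → coeff R (map f p) i ≈ f (coeff R p i)
  coeff-map f f0≈0 []      i       = sym f0≈0
  coeff-map f f0≈0 (a ∷ p) zero    = refl
  coeff-map f f0≈0 (a ∷ p) (suc i) = coeff-map f f0≈0 p i

  coeff-mulLin-suc : ∀ a p i →
    coeff R (mulLin R a p) (suc i) ≈ coeff R p i + - (a * coeff R p (suc i))
  coeff-mulLin-suc a p i =
    trans (coeff-addP (0# ∷ p) (map negScale p) (suc i))
          (+-congˡ (coeff-map negScale (trans (-‿cong (zeroʳ a)) -0#≈0#) p (suc i)))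
    where
    negScale : Carrier → Carrier
    negScale b = - (a * b)

  coeff-xPow : ∀ n i → coeff R (xPow R n) i ≈ I n i
  coeff-xPow zero    zero    = refl
  coeff-xPow zero    (suc i) = refl
  coeff-xPow (suc n) zero    = refl
  coeff-xPow (suc n) (suc i) = coeff-xPow n i

  -- Whitney numbers

  module _ (m : Carrier) (α : ℕ → Carrier) where

    w : Matrix R
    w = whitney1 R α m

    whitney1-lowerTriangular : LowerTriangular w
    whitney1-lowerTriangular {zero}  {suc k} _ = refl
    whitney1-lowerTriangular {suc n} {suc k} (s≤s n<k) =
      trans (coeff-mulLin-suc (α n + natMul R n m) (genFall R α m n) k)
        (trans (+-cong (whitney1-lowerTriangular n<k)
                       (-‿cong (*-vanishesʳ (whitney1-lowerTriangular (m<n⇒m<1+n n<k)))))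
          (trans (+-identityˡ _) -0#≈0#))

    whitney1-diag : ∀ n → w n n ≈ 1#
    whitney1-diag zero    = refl
    whitney1-diag (suc n) =
      trans (coeff-mulLin-suc (α n + natMul R n m) (genFall R α m n) n)
        (trans (+-cong (whitney1-diag n)
                       (-‿cong (*-vanishesʳ (whitney1-lowerTriangular (n<1+n n)))))
          (trans (+-congˡ -0#≈0#) (+-identityʳ _)))

    module _ (W : Matrix R) (isW2 : IsWhitney2 R α m W) where

      whitney2-lowerTriangular : LowerTriangular W
      whitney2-lowerTriangular = proj₂ isW2 _ _

      open ≐-Reasoning

      W·w≐I : W · w ≐ I
      W·w≐I n i = trans (sym (proj₁ isW2 n i)) (coeff-xPow n i)

      w·W≐I : w · W ≐ I
      w·W≐I = ·-cancelʳ-unitriangular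
        (·-lowerTriangular w whitney2-lowerTriangular)
        (diagonal⇒lowerTriangular I-diagonal)
        whitney1-lowerTriangular whitney1-diag
        (begin
          w · W · w     ≈⟨ ·-assoc w w whitney2-lowerTriangular ⟩
          w · (W · w)   ≈⟨ ·-congˡ w W·w≐I ⟩
          w · I         ≈⟨ ·-identityʳ whitney1-lowerTriangular ⟩
          w             ≈⟨ ·-identityˡ w ⟨
          I · w         ∎)

      whitneyLah≐alternating·W : whitneyLah R α m W ≐ alternating w · W
      whitneyLah≐alternating·W n k =
        sym (sumN-dropˡ (suc n) k _ (λ j j<k → *-vanishesʳ (whitney2-lowerTriangular j<k)))

      K : Matrix R
      K = w · D · W

      K-lowerTriangular : LowerTriangular K
      K-lowerTriangular = ·-lowerTriangular (w · D) whitney2-lowerTriangular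

      K·K≐I : K · K ≐ I
      K·K≐I = begin
        w · D · W · (w · D · W)   ≈⟨ ·-assoc (w · D) K whitney2-lowerTriangular ⟩
        w · D · (W · (w · D · W)) ≈⟨ ·-congˡ (w · D) (·-assoc W W (·-lowerTriangular w D-lowerTriangular)) ⟨
        w · D · (W · (w · D) · W) ≈⟨ ·-congˡ (w · D) (·-congʳ W (·-assoc W D whitney1-lowerTriangular)) ⟨
        w · D · (W · w · D · W)   ≈⟨ ·-congˡ (w · D) (·-congʳ W (·-congʳ D W·w≐I)) ⟩
        w · D · (I · D · W)       ≈⟨ ·-congˡ (w · D) (·-congʳ W (·-identityˡ D)) ⟩
        w · D · (D · W)           ≈⟨ ·-assoc w (D · W) D-lowerTriangular ⟩
        w · (D · (D · W))         ≈⟨ ·-congˡ w (D·D·A≐A W) ⟩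
        w · W                     ≈⟨ w·W≐I ⟩
        I                         ∎

      L≐D·K : whitneyLah R α m W ≐ D · K
      L≐D·K = begin
        whitneyLah R α m W  ≈⟨ whitneyLah≐alternating·W ⟩
        alternating w · W   ≈⟨ ·-congʳ W (alternating≐D·A·D whitney1-lowerTriangular) ⟩
        D · w · D · W       ≈⟨ ·-congʳ W (·-assoc D D whitney1-lowerTriangular) ⟩
        D · (w · D) · W     ≈⟨ ·-assoc D W (·-lowerTriangular w D-lowerTriangular) ⟩
        D · K               ∎

      D·L·D≐K·D : D · whitneyLah R α m W · D ≐ K · D
      D·L·D≐K·D = ·-congʳ D (begin
        D · whitneyLah R α m W   ≈⟨ ·-congˡ D L≐D·K ⟩
        D · (D · K)              ≈⟨ D·D·A≐A K ⟩
        K                        ∎)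

      D·L·D-inverseˡ : D · whitneyLah R α m W · D · whitneyLah R α m W ≐ I
      D·L·D-inverseˡ = begin
        D · whitneyLah R α m W · D · whitneyLah R α m W  ≈⟨ ·-cong D·L·D≐K·D L≐D·K ⟩
        K · D · (D · K)                                  ≈⟨ ·-assoc K (D · K) D-lowerTriangular ⟩
        K · (D · (D · K))                                ≈⟨ ·-congˡ K (D·D·A≐A K) ⟩
        K · K                                            ≈⟨ K·K≐I ⟩
        I                                                ∎

      D·L·D-inverseʳ : whitneyLah R α m W · (D · whitneyLah R α m W · D) ≐ I
      D·L·D-inverseʳ = begin
        whitneyLah R α m W · (D · whitneyLah R α m W · D)  ≈⟨ ·-cong L≐D·K D·L·D≐K·D ⟩
        D · K · (K · D)                                    ≈⟨ ·-assoc D (K · D) K-lowerTriangular ⟩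
        D · (K · (K · D))                                  ≈⟨ ·-congˡ D (·-assoc K D K-lowerTriangular) ⟨
        D · (K · K · D)                                    ≈⟨ ·-congˡ D (·-congʳ D K·K≐I) ⟩
        D · (I · D)                                        ≈⟨ ·-congˡ D (·-identityˡ D) ⟩
        D · D                                              ≈⟨ D·D≐I ⟩
        I                                                  ∎

mainTheorem14 : {c ℓ : Level} (R : CommutativeRing c ℓ)
    → (m : CommutativeRing.Carrier R)
    → (α : ℕ → CommutativeRing.Carrier R)
    → (W : ℕ → ℕ → CommutativeRing.Carrier R)
    → IsWhitney2 R α m W
    → let L = whitneyLah R α m W
          DLD = lowerMul R (lowerMul R (signDiag R) L) (signDiag R)
      in (∀ n k → CommutativeRing._≈_ R (lowerMul R DLD L n k) (identityM R n k))
         × (∀ n k → CommutativeRing._≈_ R (lowerMul R L DLD n k) (identityM R n k))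
mainTheorem14 R m α W isW2 = D·L·D-inverseˡ m α W isW2 , D·L·D-inverseʳ m α W isW2
  where open WhitneyMatrices R
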